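{- Let $G=(V\cup\{s\},E)$ be a finite, connected, undirected, loop-free graph (multiple edges allowed) with sink $s\notin V$, and let $p\in(0,1)$. Then ${\sf Det}(G)\subseteq{\sf Sto}(G)$.
   Context: $d^G(v)$ is the degree of $v$ (with multiplicity). A configuration is $\eta\in\mathbb{Z}_{\ge0}^V$; it is stable if $\eta_v\le d^G(v)$ for all $v\in V$; $\eta^{\max}=(d^G(v))_{v\in V}$. A legal toppling at $x\in V$ (allowed when $\eta_x>d^G(x)$) in the Abelian sandpile model (ASM) removes $d^G(x)$ grains from $x$ and adds one grain to the other endpoint of each edge at $x$ (grains sent to $s$ disappear). In the stochastic sandpile model (SSM) with parameter $p$, a legal stochastic toppling at $x$ chooses independently for each edge $e=\{x,y\}$ a Bernoulli($p$) variable $B_e$, removes $\sum_e B_e$ grains from $x$ and adds $B_e$ grains to $y$ if $y\ne s$. Each model defines a Markov chain on stable configurations: at each step, add one grain at a random vertex of $V$ (chosen i.i.d. from a distribution with support $V$), then perform legal topplings until the configuration is stable. ${\sf Det}(G)$ is the set of recurrent configurations of the ASM chain (the recurrent class containing $\eta^{\max}$), and ${\sf Sto}(G)$ is the set of recurrent configurations of the SSM chain (the recurrent class containing $\eta^{\max}$). -}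

module Defs where

open import Data.Nat using (ℕ; zero; suc; _+_; _∸_; _≤_; _<_)
open import Data.Fin using (Fin; zero; suc; _≟_)
open import Data.List using (List; map; allFin)
open import Data.Nat.ListAction using (sum)
open import Data.Bool using (Bool; true; false; if_then_else_; _∧_; _∨_)
open import Data.Product using (_×_; _,_; Σ; ∃; ∃-syntax)
open import Data.Sum using (_⊎_)
open import Relation.Nullary using (¬_)
open import Relation.Nullary.Decidable using (⌊_⌋)
open import Relation.Binary.PropositionalEquality using (_≡_; _≢_)
open import Relation.Binary.Construct.Closure.ReflexiveTransitive using (Star)

-- Vertices of G are Fin (suc n): the sink s is `zero`, and the non-sink
-- vertex v ∈ V = Fin n corresponds to `suc v`.
Vtx : ℕ → Set
Vtx n = Fin (suc n)

sink : ∀ {n} → Vtx n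
sink = zero

-- A finite undirected multigraph given by an explicit list of m edges;
-- edge i joins the endpoints (u , w) (orientation irrelevant).
record Multigraph (n : ℕ) : Set where
  field
    m    : ℕ
    edge : Fin m → Vtx n × Vtx n

open Multigraph public

LoopFree : ∀ {n} → Multigraph n → Set
LoopFree G = ∀ i → let (u , w) = edge G i in u ≢ w

Adj : ∀ {n} → Multigraph n → Vtx n → Vtx n → Set
Adj G u w = ∃[ i ] (edge G i ≡ (u , w) ⊎ edge G i ≡ (w , u))

Connected : ∀ {n} → Multigraph n → Set
Connected {n} G = (u w : Vtx n) → Star (Adj G) u w

sumE : ∀ {n} (G : Multigraph n) → (Fin (m G) → ℕ) → ℕ
sumE G f = sum (map f (allFin (m G)))

incident : ∀ {n} → Vtx n → Vtx n × Vtx n → ℕ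
incident x (u , w) = if ⌊ u ≟ x ⌋ ∨ ⌊ w ≟ x ⌋ then 1 else 0

joins : ∀ {n} → Vtx n → Vtx n → Vtx n × Vtx n → ℕ
joins x y (u , w) =
  if (⌊ u ≟ x ⌋ ∧ ⌊ w ≟ y ⌋) ∨ (⌊ u ≟ y ⌋ ∧ ⌊ w ≟ x ⌋) then 1 else 0

deg : ∀ {n} → Multigraph n → Fin n → ℕ
deg G v = sumE G (λ i → incident (suc v) (edge G i))

mult : ∀ {n} → Multigraph n → Vtx n → Vtx n → ℕ
mult G x y = sumE G (λ i → joins x y (edge G i))

Config : ℕ → Set
Config n = Fin n → ℕ

Stable : ∀ {n} → Multigraph n → Config n → Set
Stable G η = ∀ v → η v ≤ deg G v

ηmax : ∀ {n} → Multigraph n → Config n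
ηmax G v = deg G v

AddGrain : ∀ {n} → Config n → Fin n → Config n → Set
AddGrain η v η' = ∀ y → η' y ≡ η y + (if ⌊ y ≟ v ⌋ then 1 else 0)

ASMTopple : ∀ {n} → Multigraph n → Config n → Config n → Set
ASMTopple G η η' = ∃[ x ] (deg G x < η x ×
  (∀ y → η' y ≡ (if ⌊ y ≟ x ⌋ then η x ∸ deg G x
                                 else η y + mult G (suc x) (suc y))))

-- legal stochastic toppling at x with Bernoulli outcomes B (one per edge;
-- outcomes on edges not at x are irrelevant).  Since p ∈ (0,1), every
-- choice of B has positive probability.
SSMTopple : ∀ {n} → Multigraph n → Config n → Config n → Set
SSMTopple G η η' = ∃[ x ] Σ (Fin (m G) → Bool) λ B → (deg G x < η x ×
  (∀ y → η' y ≡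
     (if ⌊ y ≟ x ⌋
      then η x ∸ sumE G (λ i → if B i then incident (suc x) (edge G i) else 0)
      else η y + sumE G (λ i → if B i then joins (suc x) (suc y) (edge G i) else 0))))

-- one step of the Markov chain (support of the transition kernel): from a
-- stable η, add a grain at some vertex (the addition law has support V) and
-- topple legally until stable.
ChainStep : ∀ {n} → (Config n → Config n → Set) → Multigraph n →
            Config n → Config n → Set
ChainStep Topple G η ζ = Stable G η × Stable G ζ ×
  ∃[ v ] Σ _ λ η₁ → AddGrain η v η₁ × Star Topple η₁ ζ

RecClass : ∀ {n} → (Config n → Config n → Set) → Multigraph n → Config n → Set
RecClass Topple G ζ =
  Star (ChainStep Topple G) (ηmax G) ζ × Star (ChainStep Topple G) ζ (ηmax G)

Det : ∀ {n} → Multigraph n → Config n → Set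
Det G = RecClass (ASMTopple G) G

Sto : ∀ {n} → Multigraph n → Config n → Set
Sto G = RecClass (SSMTopple G) G

module Submission where

-- A legal ASM toppling at x is exactly the stochastic toppling at x whose
-- Bernoulli outcomes are all 1: every edge at x then fires, so x loses
-- d^G(x) grains and each neighbour y gains mult(x, y) grains.  Because
-- p ∈ (0,1), this outcome has positive probability, so every ASM toppling
-- is a possible SSM toppling.
--
-- The rest is monotonicity of the constructions in Defs with respect to
-- the toppling relation: if every step of one toppling relation is a step
-- of another, then (1) every chain step of the first model is a chain step
-- of the second, and (2) the communicating class of ηmax for the first is
-- contained in that of the second.  Applying (2) to the inclusion of ASM
-- topplings in SSM topplings gives the theorem.

open import Defs
open import Data.Nat using (ℕ)
open import Data.Bool using (true)
open import Data.Product using (_,_)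
open import Relation.Binary.Construct.Closure.ReflexiveTransitive using (map)

_⊆ₜ_ : ∀ {n} → (T U : Config n → Config n → Set) → Set
T ⊆ₜ U = ∀ {η η'} → T η η' → U η η'

-- An ASM toppling is the stochastic toppling at the same vertex with all
-- Bernoulli outcomes equal to 1; the two update rules then agree
-- definitionally, since `if true then a else 0` reduces to `a`.
asm⊆ssm : ∀ {n} (G : Multigraph n) → ASMTopple G ⊆ₜ SSMTopple G
asm⊆ssm G (x , unstable , update) = x , (λ _ → true) , unstable , update

chainStep-mono : ∀ {n} (G : Multigraph n) {T U : Config n → Config n → Set} →
                 T ⊆ₜ U → ChainStep T G ⊆ₜ ChainStep U G
chainStep-mono G T⊆U (stable , stable' , v , η₁ , add , topplings) =
  stable , stable' , v , η₁ , add , map T⊆U topplings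

recClass-mono : ∀ {n} (G : Multigraph n) {T U : Config n → Config n → Set} →
                T ⊆ₜ U → ∀ ζ → RecClass T G ζ → RecClass U G ζ
recClass-mono G T⊆U ζ (fromMax , toMax) =
  map (chainStep-mono G T⊆U) fromMax , map (chainStep-mono G T⊆U) toMax

proposition2p3 : (n : ℕ) (G : Multigraph n) → LoopFree G → Connected G →
    (ζ : Config n) → Det G ζ → Sto G ζ
proposition2p3 n G _ _ = recClass-mono G (asm⊆ssm G)
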